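{- Assume $\mathcal{L}_S, \mathcal{L}_T$ each define a predicate $\cdot\checkmark : \mathcal{P} \to \mathbb{B}$. An encoding $[\![\cdot]\!] : \mathcal{P}_S \to \mathcal{P}_T$ is success sensitive and weakly operationally corresponding w.r.t. a preorder $\mathcal{R}_T \subseteq \mathcal{P}_T^2$ that is a success respecting correspondence simulation iff $\exists \mathcal{R} .\ \left( \forall S .\ \left( S, [\![S]\!] \right) \in \mathcal{R} \right) \wedge \mathcal{R}_T = \mathcal{R}|_{\mathcal{P}_T} \wedge \mathcal{R}$ respects success $\wedge \left( \forall S, T .\ \left( S, T \right) \in \mathcal{R} \rightarrow \left( [\![S]\!], T \right) \in \mathcal{R}_T \right) \wedge \mathcal{R}$ is a preorder and a correspondence simulation.
   Context: Source $\langle \mathcal{P}_S, \longmapsto_S\rangle$, target $\langle \mathcal{P}_T, \longmapsto_T\rangle$, encoding $[\![\cdot]\!]$; $\longmapsto^{*}$ is the reflexive transitive closure of $\longmapsto$; $\mathcal{R}\subseteq(\mathcal{P}_S\uplus\mathcal{P}_T)^2$, $\mathcal{R}|_{\mathcal{P}_T}$ its restriction to target terms. $P\Downarrow\checkmark$ means $\exists P'.\ P\longmapsto^{*}P' \wedge P'\checkmark$; success sensitive means $S\Downarrow\checkmark$ iff $[\![S]\!]\Downarrow\checkmark$ for all $S$; a relation respects success if related terms agree on $\Downarrow\checkmark$. Weak operational correspondence w.r.t. $\mathcal{R}_T$: $S \longmapsto_S^{*} S'$ implies $\exists T.\ [\![S]\!] \longmapsto_T^{*} T \wedge ([\![S']\!],T)\in\mathcal{R}_T$,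 and $[\![S]\!]\longmapsto_T^{*} T$ implies $\exists S',T'.\ S\longmapsto_S^{*}S' \wedge T\longmapsto_T^{*}T' \wedge ([\![S']\!],T')\in\mathcal{R}_T$. A correspondence simulation $\mathcal{R}$: for $(P,Q)\in\mathcal{R}$, $P\longmapsto^{*}P'$ implies $\exists Q'.\ Q\longmapsto^{*}Q'\wedge(P',Q')\in\mathcal{R}$, and $Q\longmapsto^{*}Q'$ implies $\exists P'',Q''.\ P\longmapsto^{*}P''\wedge Q'\longmapsto^{*}Q''\wedge(P'',Q'')\in\mathcal{R}$. -}

module Defs where

open import Level using (Level; _⊔_; suc; Lift)
open import Data.Empty using (⊥)
open import Data.Bool using (Bool; true)
open import Data.Sum using (_⊎_; inj₁; inj₂; [_,_])
open import Data.Product using (_×_; ∃; ∃-syntax; _,_)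
open import Function.Bundles using (_⇔_)
open import Relation.Binary.Core using (Rel)
open import Relation.Binary.Structures using (IsPreorder)
open import Relation.Binary.PropositionalEquality using (_≡_)
open import Relation.Binary.Construct.Closure.ReflexiveTransitive using (Star)

record Lang (a ℓ : Level) : Set (suc (a ⊔ ℓ)) where
  field
    Proc : Set a
    _⟼_  : Rel Proc ℓ
    ✓    : Proc → Bool

module _ {a ℓ : Level} (L : Lang a ℓ) where
  open Lang L

  _⟼*_ : Rel Proc (a ⊔ ℓ)
  _⟼*_ = Star _⟼_

  Succ : Proc → Set
  Succ P = ✓ P ≡ true

  _⇓✓ : Proc → Set (a ⊔ ℓ)
  P ⇓✓ = ∃[ P' ] (P ⟼* P' × Succ P')

  RespectsSuccess : ∀ {r} → Rel Proc r → Set (a ⊔ ℓ ⊔ r)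
  RespectsSuccess R = ∀ P Q → R P Q → (P ⇓✓ ⇔ Q ⇓✓)

  CorrespondenceSimulation : ∀ {r} → Rel Proc r → Set (a ⊔ ℓ ⊔ r)
  CorrespondenceSimulation R =
    ∀ P Q → R P Q →
      (∀ P' → P ⟼* P' → ∃[ Q' ] (Q ⟼* Q' × R P' Q'))
    × (∀ Q' → Q ⟼* Q' → ∃[ P'' ] ∃[ Q'' ] (P ⟼* P'' × Q' ⟼* Q'' × R P'' Q''))

  Preorder′ : ∀ {r} → Rel Proc r → Set (a ⊔ r)
  Preorder′ R = IsPreorder _≡_ R

UnionStep : ∀ {a ℓ} (S T : Lang a ℓ) → Rel (Lang.Proc S ⊎ Lang.Proc T) ℓ
UnionStep S T (inj₁ P) (inj₁ P') = Lang._⟼_ S P P'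
UnionStep S T (inj₂ Q) (inj₂ Q') = Lang._⟼_ T Q Q'
UnionStep {ℓ = ℓ} S T (inj₁ _) (inj₂ _) = Lift ℓ ⊥
UnionStep {ℓ = ℓ} S T (inj₂ _) (inj₁ _) = Lift ℓ ⊥

_⊎L_ : ∀ {a ℓ} → Lang a ℓ → Lang a ℓ → Lang a ℓ
S ⊎L T = record
  { Proc = Lang.Proc S ⊎ Lang.Proc T
  ; _⟼_  = UnionStep S T
  ; ✓    = [ Lang.✓ S , Lang.✓ T ]
  }

Restrict : ∀ {a ℓ r} (S T : Lang a ℓ) → Rel (Lang.Proc S ⊎ Lang.Proc T) r → Rel (Lang.Proc T) r
Restrict S T R Q Q' = R (inj₂ Q) (inj₂ Q')

module _ {a ℓ : Level} (S T : Lang a ℓ) (enc : Lang.Proc S → Lang.Proc T) where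
  open Lang S renaming (Proc to PS)
  open Lang T renaming (Proc to PT)

  SuccessSensitive : Set (a ⊔ ℓ)
  SuccessSensitive = ∀ s → (_⇓✓ S s ⇔ _⇓✓ T (enc s))

  WeakOpCorr : ∀ {r} → Rel PT r → Set (a ⊔ ℓ ⊔ r)
  WeakOpCorr RT =
    (∀ s s' → _⟼*_ S s s' → ∃[ t ] (_⟼*_ T (enc s) t × RT (enc s') t))
    × (∀ s t → _⟼*_ T (enc s) t →
         ∃[ s' ] ∃[ t' ] (_⟼*_ S s s' × _⟼*_ T t t' × RT (enc s') t'))

-- Reductions of the union language never cross between source and target terms, so
-- convergence, reductions and simulations of R restricted to either side are exactly those
-- of the original languages. Backwards, R_T is the target part of R, and R itself supplies
-- success sensitivity and weak operational correspondence through the pairs (S, ⟦S⟧).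
-- Forwards, take R to be the identity on source terms, R_T on target terms and
-- {(S, T) | (⟦S⟧, T) ∈ R_T} between them; the only non-trivial case is that of a
-- source–target pair, where operational correspondence and simulation by R_T are chained.
module Submission where

open import Defs
open import Level using (Level; Lift; lift; _⊔_)
open import Data.Empty using (⊥)
open import Data.Sum using (_⊎_; inj₁; inj₂)
open import Data.Product using (_×_; Σ-syntax; ∃-syntax; _,_; proj₁; proj₂)
open import Function.Bundles using (_⇔_; mk⇔; Equivalence)
open import Function.Construct.Composition using () renaming (equivalence to infixr 5 _⟨⇔⟩_)
open import Function.Construct.Symmetry using (⇔-sym)
open import Function.Construct.Identity using (⇔-id)
open import Relation.Binary.Core using (Rel)
open import Relation.Binary.Definitions using (Transitive)
open import Relation.Binary.Structures using (IsPreorder)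
open import Relation.Binary.PropositionalEquality using (refl; isEquivalence)
open import Relation.Binary.Construct.Closure.ReflexiveTransitive using (ε; _◅_; _◅◅_; gmap)

open Lang using (Proc)

module UnionReductions {a ℓ : Level} (S T : Lang a ℓ) where

  inj₁-⟼* : ∀ {s s'} → _⟼*_ S s s' → _⟼*_ (S ⊎L T) (inj₁ s) (inj₁ s')
  inj₁-⟼* = gmap inj₁ (λ step → step)

  inj₂-⟼* : ∀ {t t'} → _⟼*_ T t t' → _⟼*_ (S ⊎L T) (inj₂ t) (inj₂ t')
  inj₂-⟼* = gmap inj₂ (λ step → step)

  data LeftReduct (s : Proc S) : Proc (S ⊎L T) → Set (a ⊔ ℓ) where
    left : ∀ {s'} → _⟼*_ S s s' → LeftReduct s (inj₁ s')

  data RightReduct (t : Proc T) : Proc (S ⊎L T) → Set (a ⊔ ℓ) where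
    right : ∀ {t'} → _⟼*_ T t t' → RightReduct t (inj₂ t')

  inj₁-⟼*-inv : ∀ {s P} → _⟼*_ (S ⊎L T) (inj₁ s) P → LeftReduct s P
  inj₁-⟼*-inv ε = left ε
  inj₁-⟼*-inv (_◅_ {j = inj₁ _} step steps) with inj₁-⟼*-inv steps
  ... | left steps′ = left (step ◅ steps′)
  inj₁-⟼*-inv (_◅_ {j = inj₂ _} (lift ()) _)

  inj₂-⟼*-inv : ∀ {t P} → _⟼*_ (S ⊎L T) (inj₂ t) P → RightReduct t P
  inj₂-⟼*-inv ε = right ε
  inj₂-⟼*-inv (_◅_ {j = inj₂ _} step steps) with inj₂-⟼*-inv steps
  ... | right steps′ = right (step ◅ steps′)
  inj₂-⟼*-inv (_◅_ {j = inj₁ _} (lift ()) _)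

  ⇓✓-inj₁ : ∀ s → _⇓✓ S s ⇔ _⇓✓ (S ⊎L T) (inj₁ s)
  ⇓✓-inj₁ s = mk⇔ (λ (s' , steps , ok) → inj₁ s' , inj₁-⟼* steps , ok) from
    where
    from : _⇓✓ (S ⊎L T) (inj₁ s) → _⇓✓ S s
    from (P , steps , ok) with inj₁-⟼*-inv steps
    ... | left {s'} steps′ = s' , steps′ , ok

  ⇓✓-inj₂ : ∀ t → _⇓✓ T t ⇔ _⇓✓ (S ⊎L T) (inj₂ t)
  ⇓✓-inj₂ t = mk⇔ (λ (t' , steps , ok) → inj₂ t' , inj₂-⟼* steps , ok) from
    where
    from : _⇓✓ (S ⊎L T) (inj₂ t) → _⇓✓ T t
    from (P , steps , ok) with inj₂-⟼*-inv steps
    ... | right {t'} steps′ = t' , steps′ , ok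

module PointwiseEquivalent {a ℓ r s : Level} (L : Lang a ℓ) {R : Rel (Proc L) r} {R′ : Rel (Proc L) s}
                           (R⇔R′ : ∀ P Q → R P Q ⇔ R′ P Q) where

  private
    to : ∀ {P Q} → R P Q → R′ P Q
    to = Equivalence.to (R⇔R′ _ _)

    from : ∀ {P Q} → R′ P Q → R P Q
    from = Equivalence.from (R⇔R′ _ _)

  isPreorder : Preorder′ L R′ → Preorder′ L R
  isPreorder pre = record
    { isEquivalence = isEquivalence
    ; reflexive     = λ P≡Q → from (IsPreorder.reflexive pre P≡Q)
    ; trans         = λ PRQ QRO → from (IsPreorder.trans pre (to PRQ) (to QRO))
    }

  respectsSuccess : RespectsSuccess L R′ → RespectsSuccess L R
  respectsSuccess rs P Q PRQ = rs P Q (to PRQ)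

  correspondenceSimulation : CorrespondenceSimulation L R′ → CorrespondenceSimulation L R
  correspondenceSimulation cs P Q PRQ =
    (λ P' steps → let (Q' , steps′ , rel) = proj₁ (cs P Q (to PRQ)) P' steps
                  in Q' , steps′ , from rel)
    , (λ Q' steps → let (P'' , Q'' , stepsP , stepsQ , rel) = proj₂ (cs P Q (to PRQ)) Q' steps
                    in P'' , Q'' , stepsP , stepsQ , from rel)

module Restriction {a ℓ r : Level} (S T : Lang a ℓ) (R : Rel (Proc (S ⊎L T)) r) where
  open UnionReductions S T

  restrict-isPreorder : Preorder′ (S ⊎L T) R → Preorder′ T (Restrict S T R)
  restrict-isPreorder pre = record
    { isEquivalence = isEquivalence
    ; reflexive     = λ { refl → IsPreorder.refl pre }
    ; trans         = IsPreorder.trans pre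
    }

  restrict-respectsSuccess : RespectsSuccess (S ⊎L T) R → RespectsSuccess T (Restrict S T R)
  restrict-respectsSuccess rs t t' tRt' = ⇓✓-inj₂ t ⟨⇔⟩ rs _ _ tRt' ⟨⇔⟩ ⇔-sym (⇓✓-inj₂ t')

  restrict-correspondenceSimulation :
    CorrespondenceSimulation (S ⊎L T) R → CorrespondenceSimulation T (Restrict S T R)
  restrict-correspondenceSimulation cs t t' tRt' = simulate , correspond
    where
    simulate : ∀ t₁ → _⟼*_ T t t₁ → ∃[ t₂ ] (_⟼*_ T t' t₂ × Restrict S T R t₁ t₂)
    simulate t₁ steps with proj₁ (cs _ _ tRt') (inj₂ t₁) (inj₂-⟼* steps)
    ... | Q , steps′ , rel with inj₂-⟼*-inv steps′
    ... | right {t₂} steps″ = t₂ , steps″ , rel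

    correspond : ∀ t₁ → _⟼*_ T t' t₁ →
      ∃[ u ] ∃[ u' ] (_⟼*_ T t u × _⟼*_ T t₁ u' × Restrict S T R u u')
    correspond t₁ steps with proj₂ (cs _ _ tRt') (inj₂ t₁) (inj₂-⟼* steps)
    ... | P , Q , stepsP , stepsQ , rel with inj₂-⟼*-inv stepsP | inj₂-⟼*-inv stepsQ
    ... | right {u} stepsP′ | right {u'} stepsQ′ = u , u' , stepsP′ , stepsQ′ , rel

module EncodingFromRelation {a ℓ r : Level} (S T : Lang a ℓ) (enc : Proc S → Proc T)
                            {R : Rel (Proc (S ⊎L T)) r}
                            (s-R-enc : ∀ s → R (inj₁ s) (inj₂ (enc s))) where
  open UnionReductions S T

  successSensitive : RespectsSuccess (S ⊎L T) R → SuccessSensitive S T enc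
  successSensitive rs s = ⇓✓-inj₁ s ⟨⇔⟩ rs _ _ (s-R-enc s) ⟨⇔⟩ ⇔-sym (⇓✓-inj₂ (enc s))

  weakOpCorr : ∀ {RT : Rel (Proc T) r} → (∀ s t → R (inj₁ s) (inj₂ t) → RT (enc s) t) →
               CorrespondenceSimulation (S ⊎L T) R → WeakOpCorr S T enc RT
  weakOpCorr {RT} R⇒RT cs = complete , sound
    where
    complete : ∀ s s' → _⟼*_ S s s' → ∃[ t ] (_⟼*_ T (enc s) t × RT (enc s') t)
    complete s s' steps with proj₁ (cs _ _ (s-R-enc s)) (inj₁ s') (inj₁-⟼* steps)
    ... | Q , steps′ , rel with inj₂-⟼*-inv steps′
    ... | right {t} steps″ = t , steps″ , R⇒RT s' t rel

    sound : ∀ s t → _⟼*_ T (enc s) t →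
      ∃[ s' ] ∃[ t' ] (_⟼*_ S s s' × _⟼*_ T t t' × RT (enc s') t')
    sound s t steps with proj₂ (cs _ _ (s-R-enc s)) (inj₂ t) (inj₂-⟼* steps)
    ... | P , Q , stepsP , stepsQ , rel with inj₁-⟼*-inv stepsP | inj₂-⟼*-inv stepsQ
    ... | left {s'} stepsP′ | right {t'} stepsQ′ = s' , t' , stepsP′ , stepsQ′ , R⇒RT s' t' rel

module EncodedSimulation {a ℓ r : Level} (S T : Lang a ℓ) (enc : Proc S → Proc T)
                         {RT : Rel (Proc T) r}
                         (woc : WeakOpCorr S T enc RT) (trans : Transitive RT)
                         (cs : CorrespondenceSimulation T RT) where

  encoded-simulate : ∀ {s t} → RT (enc s) t → ∀ s' → _⟼*_ S s s' →
                     ∃[ t' ] (_⟼*_ T t t' × RT (enc s') t')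
  encoded-simulate {s} encRt s' steps =
    let (t₁ , enc⟼*t₁ , encRt₁) = proj₁ woc s s' steps
        (t₂ , t⟼*t₂ , t₁Rt₂)    = proj₁ (cs _ _ encRt) t₁ enc⟼*t₁
    in t₂ , t⟼*t₂ , trans encRt₁ t₁Rt₂

  -- Match t ⟼* t₁ by ⟦s⟧ ⟼* u, let the encoding catch up u ⟼* u₂ with a source
  -- reduction s ⟼* s₁, and match u ⟼* u₂ again from the partner u' of u.
  encoded-correspond : ∀ {s t} → RT (enc s) t → ∀ t₁ → _⟼*_ T t t₁ →
                       ∃[ s₁ ] ∃[ t₂ ] (_⟼*_ S s s₁ × _⟼*_ T t₁ t₂ × RT (enc s₁) t₂)
  encoded-correspond {s} encRt t₁ steps =
    let (u , u' , enc⟼*u , t₁⟼*u' , uRu') = proj₂ (cs _ _ encRt) t₁ steps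
        (s₁ , u₂ , s⟼*s₁ , u⟼*u₂ , encRu₂) = proj₂ woc s u enc⟼*u
        (u₃ , u'⟼*u₃ , u₂Ru₃)             = proj₁ (cs _ _ uRu') u₂ u⟼*u₂
    in s₁ , u₃ , s⟼*s₁ , t₁⟼*u' ◅◅ u'⟼*u₃ , trans encRu₂ u₂Ru₃

-- _≡_ on source terms lives in their universe level, which need not be r.
data Same {a} (r : Level) {A : Set a} (x : A) : A → Set r where
  same : Same r x x

module Extension {a ℓ r : Level} (S T : Lang a ℓ) (enc : Proc S → Proc T)
                 (RT : Rel (Proc T) r) where
  open UnionReductions S T

  extension : Rel (Proc (S ⊎L T)) r
  extension (inj₁ s) (inj₁ s') = Same r s s'
  extension (inj₁ s) (inj₂ t)  = RT (enc s) t
  extension (inj₂ _) (inj₁ _)  = Lift r ⊥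
  extension (inj₂ t) (inj₂ t') = RT t t'

  module _ (pre : Preorder′ T RT) where
    open IsPreorder pre using () renaming (refl to reflT; trans to transT)

    extension-refl : ∀ P → extension P P
    extension-refl (inj₁ _) = same
    extension-refl (inj₂ _) = reflT

    extension-trans : ∀ {P Q O} → extension P Q → extension Q O → extension P O
    extension-trans {inj₁ _} {inj₁ _} {_}      same QO      = QO
    extension-trans {inj₁ _} {inj₂ _} {inj₂ _} PQ   QO      = transT PQ QO
    extension-trans {inj₂ _} {inj₂ _} {inj₂ _} PQ   QO      = transT PQ QO
    extension-trans {_}      {inj₂ _} {inj₁ _} _    (lift ())
    extension-trans {inj₂ _} {inj₁ _} {_}      (lift ()) _

    extension-isPreorder : Preorder′ (S ⊎L T) extension
    extension-isPreorder = record
      { isEquivalence = isEquivalence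
      ; reflexive     = λ { {P} refl → extension-refl P }
      ; trans         = λ {P} {Q} {O} → extension-trans {P} {Q} {O}
      }

    extension-correspondenceSimulation :
      WeakOpCorr S T enc RT → CorrespondenceSimulation T RT →
      CorrespondenceSimulation (S ⊎L T) extension
    extension-correspondenceSimulation woc cs = simulation
      where
      open EncodedSimulation S T enc woc transT cs

      simulation : CorrespondenceSimulation (S ⊎L T) extension
      simulation (inj₁ s) (inj₁ .s) same =
        (λ P' steps → P' , steps , extension-refl P')
        , (λ Q' steps → Q' , Q' , steps , ε , extension-refl Q')
      simulation (inj₁ s) (inj₂ t) encRt = simulate , correspond
        where
        simulate : ∀ P' → _⟼*_ (S ⊎L T) (inj₁ s) P' →
                   ∃[ Q' ] (_⟼*_ (S ⊎L T) (inj₂ t) Q' × extension P' Q')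
        simulate P' steps with inj₁-⟼*-inv steps
        ... | left {s'} steps′ =
          let (t' , t⟼*t' , rel) = encoded-simulate encRt s' steps′
          in inj₂ t' , inj₂-⟼* t⟼*t' , rel

        correspond : ∀ Q' → _⟼*_ (S ⊎L T) (inj₂ t) Q' →
          ∃[ P'' ] ∃[ Q'' ] (_⟼*_ (S ⊎L T) (inj₁ s) P'' × _⟼*_ (S ⊎L T) Q' Q'' × extension P'' Q'')
        correspond Q' steps with inj₂-⟼*-inv steps
        ... | right {t₁} steps′ =
          let (s₁ , t₂ , s⟼*s₁ , t₁⟼*t₂ , rel) = encoded-correspond encRt t₁ steps′
          in inj₁ s₁ , inj₂ t₂ , inj₁-⟼* s⟼*s₁ , inj₂-⟼* t₁⟼*t₂ , rel
      simulation (inj₂ t) (inj₂ t') tRt' = simulate , correspond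
        where
        simulate : ∀ P' → _⟼*_ (S ⊎L T) (inj₂ t) P' →
                   ∃[ Q' ] (_⟼*_ (S ⊎L T) (inj₂ t') Q' × extension P' Q')
        simulate P' steps with inj₂-⟼*-inv steps
        ... | right {t₁} steps′ =
          let (t₂ , t'⟼*t₂ , rel) = proj₁ (cs _ _ tRt') t₁ steps′
          in inj₂ t₂ , inj₂-⟼* t'⟼*t₂ , rel

        correspond : ∀ Q' → _⟼*_ (S ⊎L T) (inj₂ t') Q' →
          ∃[ P'' ] ∃[ Q'' ] (_⟼*_ (S ⊎L T) (inj₂ t) P'' × _⟼*_ (S ⊎L T) Q' Q'' × extension P'' Q'')
        correspond Q' steps with inj₂-⟼*-inv steps
        ... | right {t₁} steps′ =
          let (u , u' , t⟼*u , t₁⟼*u' , rel) = proj₂ (cs _ _ tRt') t₁ steps′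
          in inj₂ u , inj₂ u' , inj₂-⟼* t⟼*u , inj₂-⟼* t₁⟼*u' , rel
      simulation (inj₂ _) (inj₁ _) (lift ())

  extension-respectsSuccess :
    SuccessSensitive S T enc → RespectsSuccess T RT → RespectsSuccess (S ⊎L T) extension
  extension-respectsSuccess ss rs (inj₁ s) (inj₁ .s) same = ⇔-id _
  extension-respectsSuccess ss rs (inj₁ s) (inj₂ t) encRt =
    ⇔-sym (⇓✓-inj₁ s) ⟨⇔⟩ ss s ⟨⇔⟩ rs _ _ encRt ⟨⇔⟩ ⇓✓-inj₂ t
  extension-respectsSuccess ss rs (inj₂ t) (inj₂ t') tRt' =
    ⇔-sym (⇓✓-inj₂ t) ⟨⇔⟩ rs _ _ tRt' ⟨⇔⟩ ⇓✓-inj₂ t'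
  extension-respectsSuccess ss rs (inj₂ _) (inj₁ _) (lift ())

lemma12 : ∀ {a ℓ r : Level} (S T : Lang a ℓ) (enc : Lang.Proc S → Lang.Proc T)
          (RT : Rel (Lang.Proc T) r) →
          ( SuccessSensitive S T enc
            × WeakOpCorr S T enc RT
            × Preorder′ T RT
            × RespectsSuccess T RT
            × CorrespondenceSimulation T RT )
          ⇔
          ( Σ[ R ∈ Rel (Lang.Proc S ⊎ Lang.Proc T) r ] ( (∀ s → R (inj₁ s) (inj₂ (enc s)))
                   × (∀ t t' → RT t t' ⇔ Restrict S T R t t')
                   × RespectsSuccess (S ⊎L T) R
                   × (∀ s t → R (inj₁ s) (inj₂ t) → RT (enc s) t)
                   × Preorder′ (S ⊎L T) R
                   × CorrespondenceSimulation (S ⊎L T) R ) )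
lemma12 S T enc RT = mk⇔
  (λ (ss , woc , pre , rs , cs) →
    let open Extension S T enc RT
    in extension
       , (λ s → IsPreorder.refl pre)
       , (λ t t' → ⇔-id _)
       , extension-respectsSuccess ss rs
       , (λ s t encRt → encRt)
       , extension-isPreorder pre
       , extension-correspondenceSimulation pre woc cs)
  (λ (R , s-R-enc , RT⇔R , rs , R⇒RT , pre , cs) →
    let open Restriction S T R
        open PointwiseEquivalent T RT⇔R
        open EncodingFromRelation S T enc {R} s-R-enc
    in successSensitive rs
       , weakOpCorr {RT} R⇒RT cs
       , isPreorder (restrict-isPreorder pre)
       , respectsSuccess (restrict-respectsSuccess rs)
       , correspondenceSimulation (restrict-correspondenceSimulation cs))
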